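{- Let $M$ be a matroid of rank 3 with ground set $[n]$. If $M$ has no minor isomorphic to $P_6$, then $\kappa(M)\le 13+19n$.
   Context: $P_6$ is the simple rank-3 matroid on $\{a,b,c,d,e,f\}$ whose only dependent 3-element set is $\{a,b,c\}$. A non-basis of $M$ is a set of size $r(M)$ that is not a basis. A flat $F$ covers $X$ if $|X\cap F|>r_M(F)$. A flat cover is a set of flats covering every non-basis; $\kappa(M)$ is the minimum size of a flat cover of $M$. -}

module Defs where

open import Data.Nat using (ℕ; zero; suc; _+_; _≤_; _<_; _⊓_)
open import Data.Bool using (Bool; true; false; if_then_else_)
open import Data.Fin using (Fin) renaming (zero to fzero; suc to fsuc)
open import Data.Fin.Subset using (Subset; _∈_; _∉_; _⊆_; _∪_; _∩_; ⁅_⁆; ∣_∣; ⊤; ⊥)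
open import Data.Vec using (Vec; []; _∷_)
open import Data.Vec.Properties using (≡-dec)
import Data.Bool as B
open import Data.List using (List; length)
open import Data.List.Relation.Unary.Any using (Any)
open import Data.List.Relation.Unary.All using (All)
open import Data.Product using (Σ; ∃; _×_)
open import Relation.Nullary using (¬_; does)
open import Relation.Binary.PropositionalEquality using (_≡_)
open import Function.Definitions using (Injective)

record Matroid (n : ℕ) : Set where
  field
    r          : Subset n → ℕ
    r-bound    : ∀ X → r X ≤ ∣ X ∣
    r-mono     : ∀ X Y → X ⊆ Y → r X ≤ r Y
    r-submod   : ∀ X Y → r (X ∪ Y) + r (X ∩ Y) ≤ r X + r Y

open Matroid public

rk : ∀ {n} → Matroid n → ℕ
rk M = r M ⊤

Independent : ∀ {n} → Matroid n → Subset n → Set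
Independent M X = r M X ≡ ∣ X ∣

Basis : ∀ {n} → Matroid n → Subset n → Set
Basis M X = Independent M X × (∀ Y → X ⊆ Y → Independent M Y → X ≡ Y)

NonBasis : ∀ {n} → Matroid n → Subset n → Set
NonBasis M X = (∣ X ∣ ≡ rk M) × ¬ Basis M X

Flat : ∀ {n} → Matroid n → Subset n → Set
Flat M F = ∀ e → e ∉ F → r M F < r M (F ∪ ⁅ e ⁆)

Covers : ∀ {n} → Matroid n → Subset n → Subset n → Set
Covers M F X = r M F < ∣ X ∩ F ∣

FlatCover : ∀ {n} → Matroid n → List (Subset n) → Set
FlatCover M Fs = All (Flat M) Fs × (∀ X → NonBasis M X → Any (λ F → Covers M F X) Fs)

κ≤ : ∀ {n} → Matroid n → ℕ → Set
κ≤ M k = Σ (List (Subset _)) λ Fs → FlatCover M Fs × length Fs ≤ k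

image : ∀ {m n} → (Fin m → Fin n) → Subset m → Subset n
image {zero}  φ []      = ⊥
image {suc m} φ (b ∷ X) = (if b then ⁅ φ fzero ⁆ else ⊥) ∪ image (λ i → φ (fsuc i)) X

-- P6 on {a,b,c,d,e,f} = Fin 6 (a,b,c = 0,1,2): rank-3, simple,
-- only dependent 3-set is {a,b,c}.
abc : Subset 6
abc = true ∷ true ∷ true ∷ false ∷ false ∷ false ∷ []

rP6 : Subset 6 → ℕ
rP6 X = if does (≡-dec B._≟_ X abc) then 2 else (∣ X ∣ ⊓ 3)

-- M has a minor isomorphic to P6: there are a contraction set C and an
-- injection φ : Fin 6 → [n] with image disjoint from C (everything else
-- deleted) such that the rank function of M / C restricted to the image,
-- r_{M/C}(Y) = r(Y ∪ C) - r(C), corresponds to that of P6 under φ.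
HasP6Minor : ∀ {n} → Matroid n → Set
HasP6Minor {n} M =
  Σ (Subset n) λ C → Σ (Fin 6 → Fin n) λ φ →
    Injective _≡_ _≡_ φ × (∀ i → φ i ∉ C) ×
    (∀ X → r M (image φ X ∪ C) Data.Nat.∸ r M C ≡ rP6 X)

-- Every element a yields the flats cl {a} and the long lines through a, the lines cl {a, b}
-- carrying a third point in general position with a and b. These flats cover every non-basis
-- {x, y, z} of a rank-3 matroid: a dependent pair {x, y} lies in cl {x} or cl {y}, and otherwise
-- {x, y, z} is a collinear triple of pairwise independent points on the long line cl {x, y}.
-- So κ(M) ≤ 19n once no element lies on 19 long lines ℓᵢ = cl {a, uᵢ} ∋ vᵢ. For such a pencil,
-- a line through a point of ℓ_A and a point of ℓ_B meets at most three further lines of the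
-- pencil: of four such meeting points at most one lies on the line through the other two points
-- of ℓ_A and ℓ_B, and three others together with a and those two points form a P₆. Discarding the
-- lines met by five suitable transversals leaves lines ℓⱼ and ℓᵢ for which
-- {a, u₀, v₀, u₁, uⱼ, uᵢ} is a P₆ with collinear triple {a, u₀, v₀}.
module Submission where

open import Defs
open import Data.Nat using (ℕ; _+_; _*_)
open import Relation.Binary.PropositionalEquality using (_≡_)
open import Relation.Nullary using (¬_)

open import Level using (0ℓ)
open import Function using (_∘_; case_of_)
open import Function.Bundles using (Equivalence)
open import Data.Bool using (Bool; true; false; not)
import Data.Bool
open import Data.Bool.Properties using (T-≡)
open import Data.Nat using (suc; _≤_; _<_; _∸_; _≡ᵇ_; _≟_; _≤?_; _<?_; z≤n; s≤s)
open import Data.Nat.Properties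
open import Data.Nat.ListAction using (sum)
open import Data.Product using (∃-syntax; _×_; _,_; proj₁; proj₂; map₂)
open import Data.Sum using (_⊎_; inj₁; inj₂)
open import Data.Fin using (Fin; #_; inject≤) renaming (zero to fzero; suc to fsuc)
import Data.Fin.Properties as Fin
open import Data.Fin.Subset
open import Data.Fin.Subset.Properties
open import Data.Vec using ([]; _∷_; here; there; tabulate)
import Data.Vec as Vec
open import Data.Vec.Properties using (≡-dec; lookup⇒[]=; []=⇒lookup; lookup∘tabulate)
open import Data.List using (List; []; _∷_; _++_; length; map; filter; allFin; concatMap; deduplicate; lookup)
import Data.List.Properties as List
open import Data.List.Membership.Propositional using () renaming (_∈_ to _∈ₗ_)
import Data.List.Membership.Propositional.Properties as Membership
open import Data.List.Relation.Unary.All using (All; []; _∷_)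
import Data.List.Relation.Unary.All as All
open import Data.List.Relation.Unary.All.Properties using (¬Any⇒All¬; all-filter)
open import Data.List.Relation.Unary.Any using (Any; here; there; any?)
import Data.List.Relation.Unary.Any as Any
open import Data.List.Relation.Unary.AllPairs using ([]; _∷_)
open import Data.List.Relation.Unary.Unique.Propositional using (Unique)
import Data.List.Relation.Unary.Unique.Propositional.Properties as Unique
import Data.List.Relation.Unary.Unique.DecPropositional.Properties as UniqueDec
open import Relation.Nullary using (Dec; yes; no; contradiction)
open import Relation.Nullary.Decidable using (map′; _⊎-dec_; _×-dec_; _→-dec_; ¬?; True; toWitness; from-yes)
open import Relation.Unary using (Pred; Decidable)
open import Relation.Binary.Definitions using (DecidableEquality)
open import Relation.Binary.PropositionalEquality
  using (_≢_; refl; sym; trans; cong; cong₂; subst; module ≡-Reasoning)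

private variable
  n : ℕ

-- Finite subsets

⁅x⁆⊆p : ∀ {x : Fin n} {p} → x ∈ p → ⁅ x ⁆ ⊆ p
⁅x⁆⊆p {x = x} x∈p y∈⁅x⁆ = subst (_∈ _) (sym (x∈⁅y⁆⇒x≡y x y∈⁅x⁆)) x∈p

x∈p⇒0<∣p∣ : ∀ {x : Fin n} {p} → x ∈ p → 0 < ∣ p ∣
x∈p⇒0<∣p∣ {x = x} x∈p = subst (_≤ _) (∣⁅x⁆∣≡1 x) (p⊆q⇒∣p∣≤∣q∣ (⁅x⁆⊆p x∈p))

x∈p∧y∈p∧x≢y⇒2≤∣p∣ : ∀ {x y : Fin n} {p} → x ∈ p → y ∈ p → x ≢ y → 2 ≤ ∣ p ∣
x∈p∧y∈p∧x≢y⇒2≤∣p∣ x∈p y∈p x≢y =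
  ≤-trans (s≤s (x∈p⇒0<∣p∣ (x∈p∧x≢y⇒x∈p-y y∈p (x≢y ∘ sym)))) (x∈p⇒∣p-x∣<∣p∣ x∈p)

x∈p∧y∈p∧z∈p⇒3≤∣p∣ : ∀ {x y z : Fin n} {p} → x ∈ p → y ∈ p → z ∈ p →
                     x ≢ y → x ≢ z → y ≢ z → 3 ≤ ∣ p ∣
x∈p∧y∈p∧z∈p⇒3≤∣p∣ x∈p y∈p z∈p x≢y x≢z y≢z = ≤-trans
  (s≤s (x∈p∧y∈p∧x≢y⇒2≤∣p∣ (x∈p∧x≢y⇒x∈p-y y∈p (x≢y ∘ sym)) (x∈p∧x≢y⇒x∈p-y z∈p (x≢z ∘ sym)) y≢z))
  (x∈p⇒∣p-x∣<∣p∣ x∈p)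

0<∣p∣⇒nonempty : ∀ (p : Subset n) → 0 < ∣ p ∣ → Nonempty p
0<∣p∣⇒nonempty (true  ∷ p) _   = fzero , here
0<∣p∣⇒nonempty (false ∷ p) 0<∣p∣ with 0<∣p∣⇒nonempty p 0<∣p∣
... | x , x∈p = fsuc x , there x∈p

∣p∪q∣≤∣p∣+∣q∣ : ∀ (p q : Subset n) → ∣ p ∪ q ∣ ≤ ∣ p ∣ + ∣ q ∣
∣p∪q∣≤∣p∣+∣q∣ []          []      = z≤n
∣p∪q∣≤∣p∣+∣q∣ (true  ∷ p) (b ∷ q) = s≤s (≤-trans (∣p∪q∣≤∣p∣+∣q∣ p q) (+-monoʳ-≤ ∣ p ∣ (∣p∣≤∣x∷p∣ b q)))
∣p∪q∣≤∣p∣+∣q∣ (false ∷ p) (true  ∷ q) = ≤-trans (s≤s (∣p∪q∣≤∣p∣+∣q∣ p q)) (≤-reflexive (sym (+-suc ∣ p ∣ ∣ q ∣)))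
∣p∪q∣≤∣p∣+∣q∣ (false ∷ p) (false ∷ q) = ∣p∪q∣≤∣p∣+∣q∣ p q

x∈p-y⇒x≢y : ∀ {x y : Fin n} {p} → x ∈ p - y → x ≢ y
x∈p-y⇒x≢y {y = fzero}  {_ ∷ p} (there _) ()
x∈p-y⇒x≢y {y = fsuc y} {_ ∷ p} (there x∈p-y) refl = x∈p-y⇒x≢y x∈p-y refl

∣p∣≤1+∣p-x∣ : ∀ (p : Subset n) x → ∣ p ∣ ≤ 1 + ∣ p - x ∣
∣p∣≤1+∣p-x∣ p x = begin
  ∣ p ∣                    ≤⟨ p⊆q⇒∣p∣≤∣q∣ p⊆⁅x⁆∪p-x ⟩
  ∣ ⁅ x ⁆ ∪ (p - x) ∣      ≤⟨ ∣p∪q∣≤∣p∣+∣q∣ ⁅ x ⁆ (p - x) ⟩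
  ∣ ⁅ x ⁆ ∣ + ∣ p - x ∣    ≡⟨ cong (_+ ∣ p - x ∣) (∣⁅x⁆∣≡1 x) ⟩
  1 + ∣ p - x ∣            ∎
  where
  open ≤-Reasoning
  p⊆⁅x⁆∪p-x : p ⊆ ⁅ x ⁆ ∪ (p - x)
  p⊆⁅x⁆∪p-x {y} y∈p with y Fin.≟ x
  ... | yes refl = x∈p∪q⁺ (inj₁ (x∈⁅x⁆ x))
  ... | no  y≢x  = x∈p∪q⁺ (inj₂ (x∈p∧x≢y⇒x∈p-y y∈p y≢x))

record Distinct₃ (p : Subset n) : Set where
  constructor distinct₃
  field
    {x y z}      : Fin n
    x∈p          : x ∈ p
    y∈p          : y ∈ p
    z∈p          : z ∈ p
    x≢y          : x ≢ y
    x≢z          : x ≢ z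
    y≢z          : y ≢ z

suc-k≤∣p∣⇒k≤∣p-x∣ : ∀ (p : Subset n) x {k} → suc k ≤ ∣ p ∣ → k ≤ ∣ p - x ∣
suc-k≤∣p∣⇒k≤∣p-x∣ p x le = ≤-pred (≤-trans le (∣p∣≤1+∣p-x∣ p x))

3≤∣p∣⇒distinct₃ : ∀ (p : Subset n) → 3 ≤ ∣ p ∣ → Distinct₃ p
3≤∣p∣⇒distinct₃ p 3≤∣p∣
  with x , x∈p ← 0<∣p∣⇒nonempty p (≤-trans (s≤s z≤n) 3≤∣p∣)
  with 2≤∣p-x∣ ← suc-k≤∣p∣⇒k≤∣p-x∣ p x 3≤∣p∣
  with y , y∈p-x ← 0<∣p∣⇒nonempty (p - x) (≤-trans (s≤s z≤n) 2≤∣p-x∣)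
  with z , z∈p-x-y ← 0<∣p∣⇒nonempty (p - x - y) (suc-k≤∣p∣⇒k≤∣p-x∣ (p - x) y 2≤∣p-x∣)
  = record
  { x∈p = x∈p ; y∈p = p─q⊆p p _ y∈p-x ; z∈p = p─q⊆p p _ z∈p-x
  ; x≢y = λ x≡y → x∈p-y⇒x≢y y∈p-x (sym x≡y)
  ; x≢z = λ x≡z → x∈p-y⇒x≢y z∈p-x (sym x≡z)
  ; y≢z = λ y≡z → x∈p-y⇒x≢y z∈p-x-y (sym y≡z) }
  where z∈p-x = p─q⊆p (p - x) _ z∈p-x-y

p⊆q∧∣q∣≤∣p∣⇒p≡q : ∀ {p q : Subset n} → p ⊆ q → ∣ q ∣ ≤ ∣ p ∣ → p ≡ q
p⊆q∧∣q∣≤∣p∣⇒p≡q {p = p} p⊆q ∣q∣≤∣p∣ = ⊆-antisym p⊆q q⊆p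
  where
  q⊆p : _ ⊆ p
  q⊆p {x} x∈q with x ∈? p
  ... | yes x∈p = x∈p
  ... | no  x∉p = contradiction ∣q∣≤∣p∣ (<⇒≱ (p⊂q⇒∣p∣<∣q∣ (p⊆q , x , x∈q , x∉p)))

∈image⁺ : ∀ {m} (φ : Fin m → Fin n) {i X} → i ∈ X → φ i ∈ image φ X
∈image⁺ φ {fzero}  {true ∷ X} here        = x∈p∪q⁺ (inj₁ (x∈⁅x⁆ (φ fzero)))
∈image⁺ φ {fsuc i} {b    ∷ X} (there i∈X) = x∈p∪q⁺ (inj₂ (∈image⁺ (φ ∘ fsuc) i∈X))

∈image⁻ : ∀ {m} (φ : Fin m → Fin n) {e} X → e ∈ image φ X → ∃[ i ] i ∈ X × φ i ≡ e
∈image⁻ φ []          e∈ = contradiction e∈ ∉⊥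
∈image⁻ φ (b ∷ X) e∈ with x∈p∪q⁻ _ (image (φ ∘ fsuc) X) e∈
∈image⁻ φ (true ∷ X)  e∈ | inj₁ e∈⁅φ0⁆ = fzero , here , sym (x∈⁅y⁆⇒x≡y _ e∈⁅φ0⁆)
∈image⁻ φ (false ∷ X) e∈ | inj₁ e∈⊥    = contradiction e∈⊥ ∉⊥
∈image⁻ φ (b ∷ X)     e∈ | inj₂ e∈rest with i , i∈X , φi≡e ← ∈image⁻ (φ ∘ fsuc) X e∈rest
  = fsuc i , there i∈X , φi≡e

∣image∣≤∣X∣ : ∀ {n m} (φ : Fin m → Fin n) X → ∣ image φ X ∣ ≤ ∣ X ∣
∣image∣≤∣X∣ {n} φ []          = ≤-reflexive (∣⊥∣≡0 n)
∣image∣≤∣X∣ φ (true ∷ X)  = begin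
  ∣ ⁅ φ fzero ⁆ ∪ image (φ ∘ fsuc) X ∣       ≤⟨ ∣p∪q∣≤∣p∣+∣q∣ ⁅ φ fzero ⁆ (image (φ ∘ fsuc) X) ⟩
  ∣ ⁅ φ fzero ⁆ ∣ + ∣ image (φ ∘ fsuc) X ∣   ≡⟨ cong (_+ ∣ image (φ ∘ fsuc) X ∣) (∣⁅x⁆∣≡1 (φ fzero)) ⟩
  1 + ∣ image (φ ∘ fsuc) X ∣                 ≤⟨ s≤s (∣image∣≤∣X∣ (φ ∘ fsuc) X) ⟩
  1 + ∣ X ∣                                  ∎
  where open ≤-Reasoning
∣image∣≤∣X∣ φ (false ∷ X) = begin
  ∣ ⊥ ∪ image (φ ∘ fsuc) X ∣    ≡⟨ cong ∣_∣ (∪-identityˡ (image (φ ∘ fsuc) X)) ⟩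
  ∣ image (φ ∘ fsuc) X ∣        ≤⟨ ∣image∣≤∣X∣ (φ ∘ fsuc) X ⟩
  ∣ X ∣                         ∎
  where open ≤-Reasoning

-- Predicates with few witnesses

module _ {A : Set} where

  AtMost : ∀ {ℓ} → ℕ → Pred A ℓ → Set ℓ
  AtMost k P = ∀ {xs} → Unique xs → All P xs → length xs ≤ k

  atMost-≡ : ∀ a → AtMost 1 (_≡ a)
  atMost-≡ a {[]}         _                  _                  = z≤n
  atMost-≡ a {_ ∷ []}     _                  _                  = s≤s z≤n
  atMost-≡ a {_ ∷ _ ∷ _}  ((x≢y ∷ _) ∷ _)    (refl ∷ refl ∷ _)  = contradiction refl x≢y

  atMost-weaken : ∀ {ℓ ℓ′ k} {P : Pred A ℓ} {Q : Pred A ℓ′} → (∀ {x} → Q x → P x) → AtMost k P → AtMost k Q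
  atMost-weaken Q⇒P ≤k uniq Qs = ≤k uniq (All.map Q⇒P Qs)

  length≤filter+filter : ∀ {ℓ} {P : Pred A ℓ} (P? : Decidable P) xs →
                         length xs ≤ length (filter P? xs) + length (filter (¬? ∘ P?) xs)
  length≤filter+filter P? []       = z≤n
  length≤filter+filter P? (x ∷ xs) with P? x
  ... | yes _ = s≤s (length≤filter+filter P? xs)
  ... | no  _ = ≤-trans (s≤s (length≤filter+filter P? xs)) (≤-reflexive (sym (+-suc _ _)))

  atMost-⊎ : ∀ {ℓ ℓ′ k l} {P : Pred A ℓ} {Q : Pred A ℓ′} → Decidable P → AtMost k P → AtMost l Q →
             AtMost (k + l) (λ x → P x ⊎ Q x)
  atMost-⊎ {P = P} {Q} P? ≤k ≤l {xs} uniq P⊎Qs = ≤-trans (length≤filter+filter P? xs)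
    (+-mono-≤ (≤k (Unique.filter⁺ P? uniq) (all-filter P? xs))
              (≤l (Unique.filter⁺ (¬? ∘ P?) uniq) (All.tabulate Q-of-¬P)))
    where
    Q-of-¬P : ∀ {x} → x ∈ₗ filter (¬? ∘ P?) xs → Q x
    Q-of-¬P x∈ with x∈xs , ¬Px ← Membership.∈-filter⁻ (¬? ∘ P?) {xs = xs} x∈
      with All.lookup P⊎Qs x∈xs
    ... | inj₁ Px = contradiction Px ¬Px
    ... | inj₂ Qx = Qx

  atMost-3 : ∀ {ℓ} {P : Pred A ℓ} →
             (∀ {w₁ w₂ w₃ w₄} → Unique (w₁ ∷ w₂ ∷ w₃ ∷ w₄ ∷ []) → ¬ All P (w₁ ∷ w₂ ∷ w₃ ∷ w₄ ∷ [])) →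
             AtMost 3 P
  atMost-3 no-four {[]}             _ _ = z≤n
  atMost-3 no-four {_ ∷ []}         _ _ = s≤s z≤n
  atMost-3 no-four {_ ∷ _ ∷ []}     _ _ = s≤s (s≤s z≤n)
  atMost-3 no-four {_ ∷ _ ∷ _ ∷ []} _ _ = s≤s (s≤s (s≤s z≤n))
  atMost-3 no-four {_ ∷ _ ∷ _ ∷ _ ∷ _}
    ((n₁₂ ∷ n₁₃ ∷ n₁₄ ∷ _) ∷ (n₂₃ ∷ n₂₄ ∷ _) ∷ (n₃₄ ∷ _) ∷ _) (P₁ ∷ P₂ ∷ P₃ ∷ P₄ ∷ _) =
    contradiction (P₁ ∷ P₂ ∷ P₃ ∷ P₄ ∷ [])
                  (no-four ((n₁₂ ∷ n₁₃ ∷ n₁₄ ∷ []) ∷ (n₂₃ ∷ n₂₄ ∷ []) ∷ (n₃₄ ∷ []) ∷ [] ∷ []))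

  lookup-injective : ∀ {xs : List A} → Unique xs → ∀ i j → lookup xs i ≡ lookup xs j → i ≡ j
  lookup-injective (_   ∷ _) fzero    fzero    _  = refl
  lookup-injective (x∉ ∷ _) fzero    (fsuc j) eq = contradiction eq (All.lookup x∉ (Membership.∈-lookup j))
  lookup-injective (x∉ ∷ _) (fsuc i) fzero    eq = contradiction (sym eq) (All.lookup x∉ (Membership.∈-lookup i))
  lookup-injective (_   ∷ u) (fsuc i) (fsuc j) eq = cong fsuc (lookup-injective u i j eq)

  length-concatMap≤ : ∀ {B : Set} (f : A → List B) {k} → (∀ x → length (f x) ≤ k) →
                      ∀ xs → length (concatMap f xs) ≤ length xs * k
  length-concatMap≤ f ≤k []       = z≤n
  length-concatMap≤ f ≤k (x ∷ xs) = begin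
    length (f x ++ concatMap f xs)          ≡⟨ List.length-++ (f x) ⟩
    length (f x) + length (concatMap f xs)  ≤⟨ +-mono-≤ (≤k x) (length-concatMap≤ f ≤k xs) ⟩
    _ + length xs * _                       ∎
    where open ≤-Reasoning

record Sparse (A : Set) : Set₁ where
  field
    Holds  : Pred A 0ℓ
    holds? : Decidable Holds
    bound  : ℕ
    atMost : AtMost bound Holds

open Sparse

≡-sparse : ∀ {m} (a : Fin m) → Sparse (Fin m)
≡-sparse a = record { Holds = _≡ a ; holds? = Fin._≟ a ; bound = 1 ; atMost = atMost-≡ a }

atMost-any : ∀ {A} (Ss : List (Sparse A)) → AtMost (sum (map bound Ss)) (λ x → Any (λ S → Holds S x) Ss)
atMost-any []       _    []        = z≤n
atMost-any []       uniq (() ∷ _)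
atMost-any (S ∷ Ss) = atMost-weaken toSum (atMost-⊎ (holds? S) (atMost S) (atMost-any Ss))
  where
  toSum : ∀ {x} → Any (λ S → Holds S x) (S ∷ Ss) → Holds S x ⊎ Any (λ S → Holds S x) Ss
  toSum (here h)  = inj₁ h
  toSum (there h) = inj₂ h

avoid : ∀ {m} (Ss : List (Sparse (Fin m))) → sum (map bound Ss) < m →
        ∃[ i ] All (λ S → ¬ Holds S i) Ss
avoid {m} Ss small = map₂ (¬Any⇒All¬ Ss) (Fin.¬∀⟶∃¬ m Bad (λ i → any? (λ S → holds? S i) Ss) ¬allBad)
  where
  Bad = λ i → Any (λ S → Holds S i) Ss
  ¬allBad : ¬ (∀ i → Bad i)
  ¬allBad allBad = <⇒≱ small (subst (_≤ sum (map bound Ss)) (List.length-tabulate (λ i → i))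
    (atMost-any Ss (Unique.allFin⁺ m) (All.tabulate (λ {i} _ → allBad i))))

-- Closure, points and lines in a matroid

module Geometry (M : Matroid n) where

  ρ : Subset n → ℕ
  ρ = r M

  ρ-mono : ∀ {X Y} → X ⊆ Y → ρ X ≤ ρ Y
  ρ-mono = r-mono M _ _

  ρ-cong : ∀ {X Y} → X ⊆ Y → Y ⊆ X → ρ X ≡ ρ Y
  ρ-cong X⊆Y Y⊆X = cong ρ (⊆-antisym X⊆Y Y⊆X)

  ρ⁅x⁆≤1 : ∀ x → ρ ⁅ x ⁆ ≤ 1
  ρ⁅x⁆≤1 x = ≤-trans (r-bound M ⁅ x ⁆) (≤-reflexive (∣⁅x⁆∣≡1 x))

  ρ-∪≤ : ∀ X Y → ρ (X ∪ Y) ≤ ρ X + ρ Y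
  ρ-∪≤ X Y = ≤-trans (m≤m+n _ (ρ (X ∩ Y))) (r-submod M X Y)

  ρ[X∪⁅e⁆]≤1+ρX : ∀ X e → ρ (X ∪ ⁅ e ⁆) ≤ 1 + ρ X
  ρ[X∪⁅e⁆]≤1+ρX X e = begin
    ρ (X ∪ ⁅ e ⁆)                      ≤⟨ ρ-∪≤ X ⁅ e ⁆ ⟩
    ρ X + ρ ⁅ e ⁆                      ≤⟨ +-monoʳ-≤ (ρ X) (ρ⁅x⁆≤1 e) ⟩
    ρ X + 1                            ≡⟨ +-comm (ρ X) 1 ⟩
    1 + ρ X                            ∎
    where open ≤-Reasoning

  X⊆X∪⁅e⁆ : ∀ {X : Subset n} {e} → X ⊆ X ∪ ⁅ e ⁆
  X⊆X∪⁅e⁆ x∈X = x∈p∪q⁺ (inj₁ x∈X)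

  e∈X∪⁅e⁆ : ∀ {X : Subset n} {e} → e ∈ X ∪ ⁅ e ⁆
  e∈X∪⁅e⁆ {e = e} = x∈p∪q⁺ (inj₂ (x∈⁅x⁆ e))

  X∪⁅e⁆⊆Y : ∀ {X Y : Subset n} {e} → X ⊆ Y → e ∈ Y → X ∪ ⁅ e ⁆ ⊆ Y
  X∪⁅e⁆⊆Y {X} {e = e} X⊆Y e∈Y x∈ with x∈p∪q⁻ X ⁅ e ⁆ x∈
  ... | inj₁ x∈X   = X⊆Y x∈X
  ... | inj₂ x∈⁅e⁆ = ⁅x⁆⊆p e∈Y x∈⁅e⁆

  cl : Subset n → Subset n
  cl X = tabulate (λ e → ρ (X ∪ ⁅ e ⁆) ≡ᵇ ρ X)

  ∈cl⁺ : ∀ {X e} → ρ (X ∪ ⁅ e ⁆) ≡ ρ X → e ∈ cl X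
  ∈cl⁺ {X} {e} eq =
    lookup⇒[]= e (cl X) (trans (lookup∘tabulate _ e) (Equivalence.to T-≡ (≡⇒≡ᵇ _ _ eq)))

  ∈cl⁻ : ∀ {X e} → e ∈ cl X → ρ (X ∪ ⁅ e ⁆) ≡ ρ X
  ∈cl⁻ {X} {e} e∈cl =
    ≡ᵇ⇒≡ _ _ (Equivalence.from T-≡ (trans (sym (lookup∘tabulate _ e)) ([]=⇒lookup e∈cl)))

  X⊆clX : ∀ {X} → X ⊆ cl X
  X⊆clX x∈X = ∈cl⁺ (ρ-cong (X∪⁅e⁆⊆Y (λ y∈X → y∈X) x∈X) X⊆X∪⁅e⁆)

  -- submodularity applied to Y and X ∪ ⁅ e ⁆, whose intersection contains X
  ∈cl⇒ρ-absorbs : ∀ {X Y e} → X ⊆ Y → e ∈ cl X → ρ (Y ∪ ⁅ e ⁆) ≤ ρ Y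
  ∈cl⇒ρ-absorbs {X} {Y} {e} X⊆Y e∈clX = +-cancelʳ-≤ (ρ X) _ _ (begin
    ρ (Y ∪ ⁅ e ⁆) + ρ X                              ≤⟨ +-mono-≤ (ρ-mono Y∪e⊆) (ρ-mono X⊆∩) ⟩
    ρ (Y ∪ (X ∪ ⁅ e ⁆)) + ρ (Y ∩ (X ∪ ⁅ e ⁆))      ≤⟨ r-submod M Y (X ∪ ⁅ e ⁆) ⟩
    ρ Y + ρ (X ∪ ⁅ e ⁆)                              ≡⟨ cong (ρ Y +_) (∈cl⁻ e∈clX) ⟩
    ρ Y + ρ X                                        ∎)
    where
    open ≤-Reasoning
    Y∪e⊆ : Y ∪ ⁅ e ⁆ ⊆ Y ∪ (X ∪ ⁅ e ⁆)
    Y∪e⊆ = X∪⁅e⁆⊆Y (p⊆p∪q _) (x∈p∪q⁺ (inj₂ e∈X∪⁅e⁆))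
    X⊆∩ : X ⊆ Y ∩ (X ∪ ⁅ e ⁆)
    X⊆∩ x∈X = x∈p∩q⁺ (X⊆Y x∈X , X⊆X∪⁅e⁆ x∈X)

  adjoin : Subset n → List (Fin n) → Subset n
  adjoin Y []       = Y
  adjoin Y (e ∷ es) = adjoin Y es ∪ ⁅ e ⁆

  Y⊆adjoin : ∀ {Y} es → Y ⊆ adjoin Y es
  Y⊆adjoin []       y∈Y = y∈Y
  Y⊆adjoin (e ∷ es) y∈Y = X⊆X∪⁅e⁆ (Y⊆adjoin es y∈Y)

  ∈adjoin : ∀ {Y e es} → e ∈ₗ es → e ∈ adjoin Y es
  ∈adjoin (here refl) = e∈X∪⁅e⁆
  ∈adjoin (there e∈es) = X⊆X∪⁅e⁆ (∈adjoin e∈es)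

  ρ-adjoin-cl : ∀ X es → All (_∈ cl X) es → ρ (adjoin X es) ≤ ρ X
  ρ-adjoin-cl X []       []               = ≤-refl
  ρ-adjoin-cl X (e ∷ es) (e∈clX ∷ es∈clX) =
    ≤-trans (∈cl⇒ρ-absorbs (Y⊆adjoin es) e∈clX) (ρ-adjoin-cl X es es∈clX)

  loop∈cl : ∀ {X e} → ρ ⁅ e ⁆ ≡ 0 → e ∈ cl X
  loop∈cl {X} {e} loop = ∈cl⁺ (≤-antisym
    (≤-trans (ρ-∪≤ X ⁅ e ⁆) (≤-reflexive (trans (cong (ρ X +_) loop) (+-identityʳ (ρ X)))))
    (ρ-mono X⊆X∪⁅e⁆))

  ρ-cl : ∀ X → ρ (cl X) ≡ ρ X
  ρ-cl X = ≤-antisym (≤-trans (ρ-mono clX⊆) (ρ-adjoin-cl X members (all-filter (_∈? cl X) (allFin n))))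
                     (ρ-mono X⊆clX)
    where
    members = filter (_∈? cl X) (allFin n)
    clX⊆ : cl X ⊆ adjoin X members
    clX⊆ {e} e∈clX = ∈adjoin (Membership.∈-filter⁺ (_∈? cl X) (Membership.∈-allFin e) e∈clX)

  cl-flat : ∀ X → Flat M (cl X)
  cl-flat X e e∉clX = begin-strict
    ρ (cl X)           ≡⟨ ρ-cl X ⟩
    ρ X                <⟨ ≤∧≢⇒< (ρ-mono X⊆X∪⁅e⁆) (e∉clX ∘ ∈cl⁺ ∘ sym) ⟩
    ρ (X ∪ ⁅ e ⁆)      ≤⟨ ρ-mono (X∪⁅e⁆⊆Y (X⊆X∪⁅e⁆ ∘ X⊆clX) e∈X∪⁅e⁆) ⟩
    ρ (cl X ∪ ⁅ e ⁆)   ∎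
    where open ≤-Reasoning

  pair : Fin n → Fin n → Subset n
  pair a b = ⁅ a ⁆ ∪ ⁅ b ⁆

  triple : Fin n → Fin n → Fin n → Subset n
  triple a b c = pair a b ∪ ⁅ c ⁆

  module _ {a b : Fin n} where

    a∈pair : a ∈ pair a b
    a∈pair = x∈p∪q⁺ (inj₁ (x∈⁅x⁆ a))

    b∈pair : b ∈ pair a b
    b∈pair = x∈p∪q⁺ (inj₂ (x∈⁅x⁆ b))

  module _ {a b c : Fin n} where

    a∈triple : a ∈ triple a b c
    a∈triple = X⊆X∪⁅e⁆ a∈pair

    b∈triple : b ∈ triple a b c
    b∈triple = X⊆X∪⁅e⁆ b∈pair

    c∈triple : c ∈ triple a b c
    c∈triple = e∈X∪⁅e⁆

  pair⊆ : ∀ {a b X} → a ∈ X → b ∈ X → pair a b ⊆ X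
  pair⊆ a∈X b∈X = X∪⁅e⁆⊆Y (⁅x⁆⊆p a∈X) b∈X

  triple⊆ : ∀ {a b c X} → a ∈ X → b ∈ X → c ∈ X → triple a b c ⊆ X
  triple⊆ a∈X b∈X c∈X = X∪⁅e⁆⊆Y (pair⊆ a∈X b∈X) c∈X

  Indep₂ : Fin n → Fin n → Set
  Indep₂ a b = 2 ≤ ρ (pair a b)

  Indep₃ : Fin n → Fin n → Fin n → Set
  Indep₃ a b c = 3 ≤ ρ (triple a b c)

  Collinear : Fin n → Fin n → Fin n → Set
  Collinear a b c = ρ (triple a b c) ≤ 2

  indep₂? : ∀ a b → Dec (Indep₂ a b)
  indep₂? a b = 2 ≤? ρ (pair a b)

  collinear? : ∀ a b c → Dec (Collinear a b c)
  collinear? a b c = ρ (triple a b c) ≤? 2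

  ¬collinear⇒indep₃ : ∀ {a b c} → ¬ Collinear a b c → Indep₃ a b c
  ¬collinear⇒indep₃ = ≰⇒>

  indep₃⇒¬collinear : ∀ {a b c} → Indep₃ a b c → ¬ Collinear a b c
  indep₃⇒¬collinear = <⇒≱

  indep₂-sym : ∀ {a b} → Indep₂ a b → Indep₂ b a
  indep₂-sym = subst (2 ≤_) (ρ-cong (pair⊆ b∈pair a∈pair) (pair⊆ b∈pair a∈pair))

  module _ {a b c : Fin n} where

    ρ-triple-swap₁₂ : ρ (triple a b c) ≡ ρ (triple b a c)
    ρ-triple-swap₁₂ = ρ-cong (triple⊆ b∈triple a∈triple c∈triple) (triple⊆ b∈triple a∈triple c∈triple)

    ρ-triple-swap₂₃ : ρ (triple a b c) ≡ ρ (triple a c b)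
    ρ-triple-swap₂₃ = ρ-cong (triple⊆ a∈triple c∈triple b∈triple) (triple⊆ a∈triple c∈triple b∈triple)

    collinear-swap₁₂ : Collinear a b c → Collinear b a c
    collinear-swap₁₂ = subst (_≤ 2) ρ-triple-swap₁₂

    collinear-swap₂₃ : Collinear a b c → Collinear a c b
    collinear-swap₂₃ = subst (_≤ 2) ρ-triple-swap₂₃

    indep₃-swap₁₂ : Indep₃ a b c → Indep₃ b a c
    indep₃-swap₁₂ = subst (3 ≤_) ρ-triple-swap₁₂

    indep₃-swap₂₃ : Indep₃ a b c → Indep₃ a c b
    indep₃-swap₂₃ = subst (3 ≤_) ρ-triple-swap₂₃

    indep₃⇒indep₂₁₂ : Indep₃ a b c → Indep₂ a b
    indep₃⇒indep₂₁₂ 3≤ρ = ≤-pred (≤-trans 3≤ρ (ρ[X∪⁅e⁆]≤1+ρX (pair a b) c))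

  module _ {a b c : Fin n} where

    indep₃⇒indep₂₁₃ : Indep₃ a b c → Indep₂ a c
    indep₃⇒indep₂₁₃ = indep₃⇒indep₂₁₂ ∘ indep₃-swap₂₃

    indep₃⇒indep₂₂₃ : Indep₃ a b c → Indep₂ b c
    indep₃⇒indep₂₂₃ = indep₃⇒indep₂₁₂ ∘ indep₃-swap₂₃ ∘ indep₃-swap₁₂

  ρ-pair≤2 : ∀ a b → ρ (pair a b) ≤ 2
  ρ-pair≤2 a b = ≤-trans (ρ[X∪⁅e⁆]≤1+ρX ⁅ a ⁆ b) (s≤s (ρ⁅x⁆≤1 a))

  collinear-aba : ∀ a b → Collinear a b a
  collinear-aba a b = ≤-trans (ρ-mono (triple⊆ a∈pair b∈pair a∈pair)) (ρ-pair≤2 a b)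

  collinear-abb : ∀ a b → Collinear a b b
  collinear-abb a b = ≤-trans (ρ-mono (triple⊆ a∈pair b∈pair b∈pair)) (ρ-pair≤2 a b)

  indep₂⇒nonloop : ∀ {a b} → Indep₂ a b → 1 ≤ ρ ⁅ a ⁆
  indep₂⇒nonloop {a} {b} 2≤ρ = ≤-pred (≤-trans 2≤ρ (ρ[X∪⁅e⁆]≤1+ρX ⁅ a ⁆ b))

  indep₂⇒nonloop₂ : ∀ {a b} → Indep₂ a b → 1 ≤ ρ ⁅ b ⁆
  indep₂⇒nonloop₂ = indep₂⇒nonloop ∘ indep₂-sym

  ⊆cl⇒ρ≤ : ∀ {A X} → A ⊆ cl X → ρ A ≤ ρ X
  ⊆cl⇒ρ≤ {X = X} A⊆clX = ≤-trans (ρ-mono A⊆clX) (≤-reflexive (ρ-cl X))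

  collinear⇒∈cl : ∀ {a b w} → Indep₂ a b → Collinear a b w → w ∈ cl (pair a b)
  collinear⇒∈cl ab abw = ∈cl⁺ (≤-antisym (≤-trans abw ab) (ρ-mono X⊆X∪⁅e⁆))

  ∈cl⇒collinear : ∀ {a b w} → w ∈ cl (pair a b) → Collinear a b w
  ∈cl⇒collinear {a} {b} w∈cl = ≤-trans (≤-reflexive (∈cl⁻ w∈cl)) (ρ-pair≤2 a b)

  collinear-on-line : ∀ {a b c d w} → Indep₂ a b →
                      Collinear a b c → Collinear a b d → Collinear a b w → Collinear c d w
  collinear-on-line {a} {b} ab abc abd abw = ≤-trans
    (⊆cl⇒ρ≤ (triple⊆ (collinear⇒∈cl ab abc) (collinear⇒∈cl ab abd) (collinear⇒∈cl ab abw)))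
    (ρ-pair≤2 a b)

  line-determined : ∀ {a b c d w} → Indep₂ a b → Indep₂ c d →
                    Collinear a b c → Collinear a b d → Collinear c d w → Collinear a b w
  line-determined {a} {b} ab cd abc abd = collinear-on-line cd
    (collinear-on-line ab abc abd (collinear-aba a b))
    (collinear-on-line ab abc abd (collinear-abb a b))

  cl-pair-≡ : ∀ {a b c} → Indep₂ a b → Indep₂ a c → Collinear a b c → cl (pair a b) ≡ cl (pair a c)
  cl-pair-≡ {a} {b} {c} ab ac abc = ⊆-antisym
    (λ e∈ → collinear⇒∈cl ac (collinear-on-line ab (collinear-aba a b) abc (∈cl⇒collinear e∈)))
    (λ e∈ → collinear⇒∈cl ab (collinear-on-line ac (collinear-aba a c) (collinear-swap₂₃ abc) (∈cl⇒collinear e∈)))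

  record P6Configuration : Set where
    field
      g    : Fin 6 → Fin n
      c012 : Collinear (g (# 0)) (g (# 1)) (g (# 2))
      i013 : Indep₃ (g (# 0)) (g (# 1)) (g (# 3))
      i014 : Indep₃ (g (# 0)) (g (# 1)) (g (# 4))
      i015 : Indep₃ (g (# 0)) (g (# 1)) (g (# 5))
      i023 : Indep₃ (g (# 0)) (g (# 2)) (g (# 3))
      i024 : Indep₃ (g (# 0)) (g (# 2)) (g (# 4))
      i025 : Indep₃ (g (# 0)) (g (# 2)) (g (# 5))
      i034 : Indep₃ (g (# 0)) (g (# 3)) (g (# 4))
      i035 : Indep₃ (g (# 0)) (g (# 3)) (g (# 5))
      i045 : Indep₃ (g (# 0)) (g (# 4)) (g (# 5))
      i123 : Indep₃ (g (# 1)) (g (# 2)) (g (# 3))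
      i124 : Indep₃ (g (# 1)) (g (# 2)) (g (# 4))
      i125 : Indep₃ (g (# 1)) (g (# 2)) (g (# 5))
      i134 : Indep₃ (g (# 1)) (g (# 3)) (g (# 4))
      i135 : Indep₃ (g (# 1)) (g (# 3)) (g (# 5))
      i145 : Indep₃ (g (# 1)) (g (# 4)) (g (# 5))
      i234 : Indep₃ (g (# 2)) (g (# 3)) (g (# 4))
      i235 : Indep₃ (g (# 2)) (g (# 3)) (g (# 5))
      i245 : Indep₃ (g (# 2)) (g (# 4)) (g (# 5))
      i345 : Indep₃ (g (# 3)) (g (# 4)) (g (# 5))

  module _ (rk≡3 : rk M ≡ 3) where

    ρ≤3 : ∀ X → ρ X ≤ 3
    ρ≤3 X = ≤-trans (ρ-mono ⊆⊤) (≤-reflexive rk≡3)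

    ρ⊥≡0 : ρ ⊥ ≡ 0
    ρ⊥≡0 = n≤0⇒n≡0 (≤-trans (r-bound M ⊥) (≤-reflexive (∣⊥∣≡0 n)))

    module _ (C : P6Configuration) where
      open P6Configuration C

      ≥₁ : ∀ X i {_ : True (i ∈? X)} → 1 ≤ ρ ⁅ g i ⁆ → 1 ≤ ρ (image g X)
      ≥₁ X i {i∈X} 1≤ρ = ≤-trans 1≤ρ (ρ-mono (⁅x⁆⊆p (∈image⁺ g (toWitness i∈X))))

      ≥₂ : ∀ X i j {_ : True (i ∈? X)} {_ : True (j ∈? X)} → Indep₂ (g i) (g j) → 2 ≤ ρ (image g X)
      ≥₂ X i j {i∈X} {j∈X} 2≤ρ =
        ≤-trans 2≤ρ (ρ-mono (pair⊆ (∈image⁺ g (toWitness i∈X)) (∈image⁺ g (toWitness j∈X))))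

      ≥₃ : ∀ X i j k {_ : True (i ∈? X)} {_ : True (j ∈? X)} {_ : True (k ∈? X)} →
           Indep₃ (g i) (g j) (g k) → 3 ≤ ρ (image g X)
      ≥₃ X i j k {i∈X} {j∈X} {k∈X} 3≤ρ = ≤-trans 3≤ρ (ρ-mono
        (triple⊆ (∈image⁺ g (toWitness i∈X)) (∈image⁺ g (toWitness j∈X)) (∈image⁺ g (toWitness k∈X))))

      -- Each lower bound is witnessed by a point, a pair or a triple other than abc inside X.
      ρ-image≥rP6 : ∀ X → rP6 X ≤ ρ (image g X)
      ρ-image≥rP6 (false ∷ false ∷ false ∷ false ∷ false ∷ false ∷ []) = z≤n
      ρ-image≥rP6 X@(true ∷ false ∷ false ∷ false ∷ false ∷ false ∷ []) = ≥₁ X (# 0) (indep₂⇒nonloop (indep₃⇒indep₂₁₂ i013))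
      ρ-image≥rP6 X@(false ∷ true ∷ false ∷ false ∷ false ∷ false ∷ []) = ≥₁ X (# 1) (indep₂⇒nonloop₂ ((indep₃⇒indep₂₁₂ i013)))
      ρ-image≥rP6 X@(false ∷ false ∷ true ∷ false ∷ false ∷ false ∷ []) = ≥₁ X (# 2) (indep₂⇒nonloop₂ ((indep₃⇒indep₂₁₂ i023)))
      ρ-image≥rP6 X@(false ∷ false ∷ false ∷ true ∷ false ∷ false ∷ []) = ≥₁ X (# 3) (indep₂⇒nonloop₂ ((indep₃⇒indep₂₁₃ i013)))
      ρ-image≥rP6 X@(false ∷ false ∷ false ∷ false ∷ true ∷ false ∷ []) = ≥₁ X (# 4) (indep₂⇒nonloop₂ ((indep₃⇒indep₂₁₃ i014)))
      ρ-image≥rP6 X@(false ∷ false ∷ false ∷ false ∷ false ∷ true ∷ []) = ≥₁ X (# 5) (indep₂⇒nonloop₂ ((indep₃⇒indep₂₁₃ i015)))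
      ρ-image≥rP6 X@(true ∷ true ∷ false ∷ false ∷ false ∷ false ∷ []) = ≥₂ X (# 0) (# 1) (indep₃⇒indep₂₁₂ i013)
      ρ-image≥rP6 X@(true ∷ false ∷ true ∷ false ∷ false ∷ false ∷ []) = ≥₂ X (# 0) (# 2) (indep₃⇒indep₂₁₂ i023)
      ρ-image≥rP6 X@(false ∷ true ∷ true ∷ false ∷ false ∷ false ∷ []) = ≥₂ X (# 1) (# 2) (indep₃⇒indep₂₁₂ i123)
      ρ-image≥rP6 X@(true ∷ false ∷ false ∷ true ∷ false ∷ false ∷ []) = ≥₂ X (# 0) (# 3) (indep₃⇒indep₂₁₃ i013)
      ρ-image≥rP6 X@(false ∷ true ∷ false ∷ true ∷ false ∷ false ∷ []) = ≥₂ X (# 1) (# 3) (indep₃⇒indep₂₂₃ i013)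
      ρ-image≥rP6 X@(false ∷ false ∷ true ∷ true ∷ false ∷ false ∷ []) = ≥₂ X (# 2) (# 3) (indep₃⇒indep₂₂₃ i023)
      ρ-image≥rP6 X@(true ∷ false ∷ false ∷ false ∷ true ∷ false ∷ []) = ≥₂ X (# 0) (# 4) (indep₃⇒indep₂₁₃ i014)
      ρ-image≥rP6 X@(false ∷ true ∷ false ∷ false ∷ true ∷ false ∷ []) = ≥₂ X (# 1) (# 4) (indep₃⇒indep₂₂₃ i014)
      ρ-image≥rP6 X@(false ∷ false ∷ true ∷ false ∷ true ∷ false ∷ []) = ≥₂ X (# 2) (# 4) (indep₃⇒indep₂₂₃ i024)
      ρ-image≥rP6 X@(false ∷ false ∷ false ∷ true ∷ true ∷ false ∷ []) = ≥₂ X (# 3) (# 4) (indep₃⇒indep₂₂₃ i034)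
      ρ-image≥rP6 X@(true ∷ false ∷ false ∷ false ∷ false ∷ true ∷ []) = ≥₂ X (# 0) (# 5) (indep₃⇒indep₂₁₃ i015)
      ρ-image≥rP6 X@(false ∷ true ∷ false ∷ false ∷ false ∷ true ∷ []) = ≥₂ X (# 1) (# 5) (indep₃⇒indep₂₂₃ i015)
      ρ-image≥rP6 X@(false ∷ false ∷ true ∷ false ∷ false ∷ true ∷ []) = ≥₂ X (# 2) (# 5) (indep₃⇒indep₂₂₃ i025)
      ρ-image≥rP6 X@(false ∷ false ∷ false ∷ true ∷ false ∷ true ∷ []) = ≥₂ X (# 3) (# 5) (indep₃⇒indep₂₂₃ i035)
      ρ-image≥rP6 X@(false ∷ false ∷ false ∷ false ∷ true ∷ true ∷ []) = ≥₂ X (# 4) (# 5) (indep₃⇒indep₂₂₃ i045)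
      ρ-image≥rP6 X@(true ∷ true ∷ true ∷ false ∷ false ∷ false ∷ []) = ≥₂ X (# 0) (# 1) (indep₃⇒indep₂₁₂ i013)
      ρ-image≥rP6 X@(true ∷ true ∷ false ∷ true ∷ false ∷ false ∷ []) = ≥₃ X (# 0) (# 1) (# 3) i013
      ρ-image≥rP6 X@(true ∷ false ∷ true ∷ true ∷ false ∷ false ∷ []) = ≥₃ X (# 0) (# 2) (# 3) i023
      ρ-image≥rP6 X@(false ∷ true ∷ true ∷ true ∷ false ∷ false ∷ []) = ≥₃ X (# 1) (# 2) (# 3) i123
      ρ-image≥rP6 X@(true ∷ true ∷ false ∷ false ∷ true ∷ false ∷ []) = ≥₃ X (# 0) (# 1) (# 4) i014
      ρ-image≥rP6 X@(true ∷ false ∷ true ∷ false ∷ true ∷ false ∷ []) = ≥₃ X (# 0) (# 2) (# 4) i024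
      ρ-image≥rP6 X@(false ∷ true ∷ true ∷ false ∷ true ∷ false ∷ []) = ≥₃ X (# 1) (# 2) (# 4) i124
      ρ-image≥rP6 X@(true ∷ false ∷ false ∷ true ∷ true ∷ false ∷ []) = ≥₃ X (# 0) (# 3) (# 4) i034
      ρ-image≥rP6 X@(false ∷ true ∷ false ∷ true ∷ true ∷ false ∷ []) = ≥₃ X (# 1) (# 3) (# 4) i134
      ρ-image≥rP6 X@(false ∷ false ∷ true ∷ true ∷ true ∷ false ∷ []) = ≥₃ X (# 2) (# 3) (# 4) i234
      ρ-image≥rP6 X@(true ∷ true ∷ false ∷ false ∷ false ∷ true ∷ []) = ≥₃ X (# 0) (# 1) (# 5) i015
      ρ-image≥rP6 X@(true ∷ false ∷ true ∷ false ∷ false ∷ true ∷ []) = ≥₃ X (# 0) (# 2) (# 5) i025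
      ρ-image≥rP6 X@(false ∷ true ∷ true ∷ false ∷ false ∷ true ∷ []) = ≥₃ X (# 1) (# 2) (# 5) i125
      ρ-image≥rP6 X@(true ∷ false ∷ false ∷ true ∷ false ∷ true ∷ []) = ≥₃ X (# 0) (# 3) (# 5) i035
      ρ-image≥rP6 X@(false ∷ true ∷ false ∷ true ∷ false ∷ true ∷ []) = ≥₃ X (# 1) (# 3) (# 5) i135
      ρ-image≥rP6 X@(false ∷ false ∷ true ∷ true ∷ false ∷ true ∷ []) = ≥₃ X (# 2) (# 3) (# 5) i235
      ρ-image≥rP6 X@(true ∷ false ∷ false ∷ false ∷ true ∷ true ∷ []) = ≥₃ X (# 0) (# 4) (# 5) i045
      ρ-image≥rP6 X@(false ∷ true ∷ false ∷ false ∷ true ∷ true ∷ []) = ≥₃ X (# 1) (# 4) (# 5) i145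
      ρ-image≥rP6 X@(false ∷ false ∷ true ∷ false ∷ true ∷ true ∷ []) = ≥₃ X (# 2) (# 4) (# 5) i245
      ρ-image≥rP6 X@(false ∷ false ∷ false ∷ true ∷ true ∷ true ∷ []) = ≥₃ X (# 3) (# 4) (# 5) i345
      ρ-image≥rP6 X@(true ∷ true ∷ true ∷ true ∷ false ∷ false ∷ []) = ≥₃ X (# 0) (# 1) (# 3) i013
      ρ-image≥rP6 X@(true ∷ true ∷ true ∷ false ∷ true ∷ false ∷ []) = ≥₃ X (# 0) (# 1) (# 4) i014
      ρ-image≥rP6 X@(true ∷ true ∷ false ∷ true ∷ true ∷ false ∷ []) = ≥₃ X (# 0) (# 1) (# 3) i013
      ρ-image≥rP6 X@(true ∷ false ∷ true ∷ true ∷ true ∷ false ∷ []) = ≥₃ X (# 0) (# 2) (# 3) i023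
      ρ-image≥rP6 X@(false ∷ true ∷ true ∷ true ∷ true ∷ false ∷ []) = ≥₃ X (# 1) (# 2) (# 3) i123
      ρ-image≥rP6 X@(true ∷ true ∷ true ∷ false ∷ false ∷ true ∷ []) = ≥₃ X (# 0) (# 1) (# 5) i015
      ρ-image≥rP6 X@(true ∷ true ∷ false ∷ true ∷ false ∷ true ∷ []) = ≥₃ X (# 0) (# 1) (# 3) i013
      ρ-image≥rP6 X@(true ∷ false ∷ true ∷ true ∷ false ∷ true ∷ []) = ≥₃ X (# 0) (# 2) (# 3) i023
      ρ-image≥rP6 X@(false ∷ true ∷ true ∷ true ∷ false ∷ true ∷ []) = ≥₃ X (# 1) (# 2) (# 3) i123
      ρ-image≥rP6 X@(true ∷ true ∷ false ∷ false ∷ true ∷ true ∷ []) = ≥₃ X (# 0) (# 1) (# 4) i014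
      ρ-image≥rP6 X@(true ∷ false ∷ true ∷ false ∷ true ∷ true ∷ []) = ≥₃ X (# 0) (# 2) (# 4) i024
      ρ-image≥rP6 X@(false ∷ true ∷ true ∷ false ∷ true ∷ true ∷ []) = ≥₃ X (# 1) (# 2) (# 4) i124
      ρ-image≥rP6 X@(true ∷ false ∷ false ∷ true ∷ true ∷ true ∷ []) = ≥₃ X (# 0) (# 3) (# 4) i034
      ρ-image≥rP6 X@(false ∷ true ∷ false ∷ true ∷ true ∷ true ∷ []) = ≥₃ X (# 1) (# 3) (# 4) i134
      ρ-image≥rP6 X@(false ∷ false ∷ true ∷ true ∷ true ∷ true ∷ []) = ≥₃ X (# 2) (# 3) (# 4) i234
      ρ-image≥rP6 X@(true ∷ true ∷ true ∷ true ∷ true ∷ false ∷ []) = ≥₃ X (# 0) (# 1) (# 3) i013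
      ρ-image≥rP6 X@(true ∷ true ∷ true ∷ true ∷ false ∷ true ∷ []) = ≥₃ X (# 0) (# 1) (# 3) i013
      ρ-image≥rP6 X@(true ∷ true ∷ true ∷ false ∷ true ∷ true ∷ []) = ≥₃ X (# 0) (# 1) (# 4) i014
      ρ-image≥rP6 X@(true ∷ true ∷ false ∷ true ∷ true ∷ true ∷ []) = ≥₃ X (# 0) (# 1) (# 3) i013
      ρ-image≥rP6 X@(true ∷ false ∷ true ∷ true ∷ true ∷ true ∷ []) = ≥₃ X (# 0) (# 2) (# 3) i023
      ρ-image≥rP6 X@(false ∷ true ∷ true ∷ true ∷ true ∷ true ∷ []) = ≥₃ X (# 1) (# 2) (# 3) i123
      ρ-image≥rP6 X@(true ∷ true ∷ true ∷ true ∷ true ∷ true ∷ []) = ≥₃ X (# 0) (# 1) (# 3) i013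

      image-abc⊆triple : image g abc ⊆ triple (g (# 0)) (g (# 1)) (g (# 2))
      image-abc⊆triple e∈ with ∈image⁻ g abc e∈
      ... | fzero                         , _ , refl = a∈triple
      ... | fsuc fzero                    , _ , refl = b∈triple
      ... | fsuc (fsuc fzero)             , _ , refl = c∈triple
      ... | fsuc (fsuc (fsuc _))          , there (there (there i∈)) , _ = contradiction i∈ ∉⊥

      ρ-image≤rP6 : ∀ X → ρ (image g X) ≤ rP6 X
      ρ-image≤rP6 X with ≡-dec Data.Bool._≟_ X abc
      ... | yes refl = ≤-trans (ρ-mono image-abc⊆triple) c012
      ... | no  _    = ⊓-glb (≤-trans (r-bound M _) (∣image∣≤∣X∣ g X)) (ρ≤3 _)

      ρ-image≡rP6 : ∀ X → ρ (image g X) ≡ rP6 X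
      ρ-image≡rP6 X = ≤-antisym (ρ-image≤rP6 X) (ρ-image≥rP6 X)

      rP6-pair : ∀ i j → i ≢ j → rP6 (⁅ i ⁆ ∪ ⁅ j ⁆) ≡ 2
      rP6-pair = from-yes (Fin.all? λ i → Fin.all? λ j → ¬? (i Fin.≟ j) →-dec rP6 (⁅ i ⁆ ∪ ⁅ j ⁆) ≟ 2)

      g-injective : ∀ {i j} → g i ≡ g j → i ≡ j
      g-injective {i} {j} gi≡gj with i Fin.≟ j
      ... | yes i≡j = i≡j
      ... | no  i≢j = contradiction 2≤1 λ { (s≤s ()) }
        where
        image-on-gi : ∀ {k} → k ∈ ⁅ i ⁆ ∪ ⁅ j ⁆ → g k ≡ g i
        image-on-gi k∈ with x∈p∪q⁻ ⁅ i ⁆ ⁅ j ⁆ k∈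
        ... | inj₁ k∈⁅i⁆ = cong g (x∈⁅y⁆⇒x≡y i k∈⁅i⁆)
        ... | inj₂ k∈⁅j⁆ = trans (cong g (x∈⁅y⁆⇒x≡y j k∈⁅j⁆)) (sym gi≡gj)
        image⊆⁅gi⁆ : image g (⁅ i ⁆ ∪ ⁅ j ⁆) ⊆ ⁅ g i ⁆
        image⊆⁅gi⁆ e∈ with k , k∈ , refl ← ∈image⁻ g (⁅ i ⁆ ∪ ⁅ j ⁆) e∈ =
          Equivalence.from x∈⁅y⁆⇔x≡y (image-on-gi k∈)
        2≤1 : 2 ≤ 1
        2≤1 = begin
          2                                 ≡⟨ sym (rP6-pair i j i≢j) ⟩
          rP6 (⁅ i ⁆ ∪ ⁅ j ⁆)               ≡⟨ sym (ρ-image≡rP6 (⁅ i ⁆ ∪ ⁅ j ⁆)) ⟩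
          ρ (image g (⁅ i ⁆ ∪ ⁅ j ⁆))       ≤⟨ ρ-mono image⊆⁅gi⁆ ⟩
          ρ ⁅ g i ⁆                         ≤⟨ ρ⁅x⁆≤1 (g i) ⟩
          1                                 ∎
          where open ≤-Reasoning

    configuration⇒P6-minor : P6Configuration → HasP6Minor M
    configuration⇒P6-minor C = ⊥ , g , g-injective C , (λ _ → ∉⊥) , λ X → begin
        ρ (image g X ∪ ⊥) ∸ ρ ⊥   ≡⟨ cong₂ _∸_ (cong ρ (∪-identityʳ (image g X))) ρ⊥≡0 ⟩
        ρ (image g X)             ≡⟨ ρ-image≡rP6 C X ⟩
        rP6 X                     ∎
      where
      open P6Configuration C
      open ≡-Reasoning

  -- Pencils of lines

  record Pencil (k : ℕ) : Set where
    field
      p              : Fin n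
      u v            : Fin k → Fin n
      p-u            : ∀ i → Indep₂ p (u i)
      p-v            : ∀ i → Indep₂ p (v i)
      u-v            : ∀ i → Indep₂ (u i) (v i)
      p-u-v          : ∀ i → Collinear p (u i) (v i)
      distinct-lines : ∀ {i j} → i ≢ j → Indep₃ p (u i) (u j)

    off-line : ∀ i {w} → Indep₃ p (u i) w → Indep₃ (u i) (v i) w
    off-line i p-u-w = ¬collinear⇒indep₃ λ u-v-w → indep₃⇒¬collinear p-u-w
      (collinear-on-line (u-v i) (collinear-swap₂₃ (collinear-swap₁₂ (p-u-v i))) (collinear-aba (u i) (v i)) u-v-w)

    pt : Fin k → Bool → Fin n
    pt i true  = u i
    pt i false = v i

    p-pt : ∀ i b → Indep₂ p (pt i b)
    p-pt i true  = p-u i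
    p-pt i false = p-v i

    pt-pt : ∀ i b → Indep₂ (pt i b) (pt i (not b))
    pt-pt i true  = u-v i
    pt-pt i false = indep₂-sym (u-v i)

    p-pt-pt : ∀ i b → Collinear p (pt i b) (pt i (not b))
    p-pt-pt i true  = p-u-v i
    p-pt-pt i false = collinear-swap₂₃ (p-u-v i)

    p-pt⇒p-u : ∀ i b {w} → Collinear p (pt i b) w → Collinear p (u i) w
    p-pt⇒p-u i true  p-u-w = p-u-w
    p-pt⇒p-u i false p-v-w = line-determined (p-u i) (p-v i) (collinear-aba p (u i)) (p-u-v i) p-v-w

    indep-across : ∀ {i j} b c → i ≢ j → Indep₃ p (pt i b) (pt j c)
    indep-across {i} {j} b c i≢j = ¬collinear⇒indep₃ λ p-pti-ptj → indep₃⇒¬collinear (distinct-lines i≢j)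
      (collinear-swap₂₃ (p-pt⇒p-u j c (collinear-swap₂₃ (p-pt⇒p-u i b p-pti-ptj))))

  -- Long lines and the flat cover

  record LongLine (a b : Fin n) : Set where
    field
      {w}   : Fin n
      a-b   : Indep₂ a b
      a-w   : Indep₂ a w
      b-w   : Indep₂ b w
      a-b-w : Collinear a b w

  longLine? : ∀ a b → Dec (LongLine a b)
  longLine? a b = map′ (λ (_ , ab , aw , bw , abw) → record { a-b = ab ; a-w = aw ; b-w = bw ; a-b-w = abw })
                       (λ L → let open LongLine L in w , a-b , a-w , b-w , a-b-w)
                       (Fin.any? λ w → indep₂? a b ×-dec indep₂? a w ×-dec indep₂? b w ×-dec collinear? a b w)

  _≟ₛ_ : DecidableEquality (Subset n)
  _≟ₛ_ = ≡-dec Data.Bool._≟_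

  longLines : Fin n → List (Subset n)
  longLines a = deduplicate _≟ₛ_ (map (cl ∘ pair a) (filter (longLine? a) (allFin n)))

  longLines-unique : ∀ a → Unique (longLines a)
  longLines-unique a = UniqueDec.deduplicate-! _≟ₛ_ (map (cl ∘ pair a) (filter (longLine? a) (allFin n)))

  ∈longLines⁺ : ∀ {a b} → LongLine a b → cl (pair a b) ∈ₗ longLines a
  ∈longLines⁺ {a} {b} L = Membership.∈-deduplicate⁺ _≟ₛ_
    (Membership.∈-map⁺ (cl ∘ pair a) (Membership.∈-filter⁺ (longLine? a) (Membership.∈-allFin b) L))

  ∈longLines⁻ : ∀ {a F} → F ∈ₗ longLines a → ∃[ b ] LongLine a b × F ≡ cl (pair a b)
  ∈longLines⁻ {a} F∈
    with b , b∈ , refl ← Membership.∈-map⁻ (cl ∘ pair a) (Membership.∈-deduplicate⁻ _≟ₛ_ _ F∈)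
    = b , proj₂ (Membership.∈-filter⁻ (longLine? a) {xs = allFin n} b∈) , refl

  module _ (a : Fin n) (19≤∣L∣ : 19 ≤ length (longLines a)) where

    private
      index : Fin 19 → Fin (length (longLines a))
      index i = inject≤ i 19≤∣L∣

      line : Fin 19 → Subset n
      line i = lookup (longLines a) (index i)

      second : ∀ i → ∃[ b ] LongLine a b × line i ≡ cl (pair a b)
      second i = ∈longLines⁻ (Membership.∈-lookup (index i))

      long : ∀ i → LongLine a (proj₁ (second i))
      long i = proj₁ (proj₂ (second i))

      line≡cl : ∀ i → line i ≡ cl (pair a (proj₁ (second i)))
      line≡cl i = proj₂ (proj₂ (second i))

      u : Fin 19 → Fin n
      u i = proj₁ (second i)

    longLines⇒pencil : Pencil 19
    longLines⇒pencil = record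
      { p              = a
      ; u              = u
      ; v              = λ i → LongLine.w (long i)
      ; p-u            = λ i → LongLine.a-b (long i)
      ; p-v            = λ i → LongLine.a-w (long i)
      ; u-v            = λ i → LongLine.b-w (long i)
      ; p-u-v          = λ i → LongLine.a-b-w (long i)
      ; distinct-lines = λ {i} {j} i≢j → ¬collinear⇒indep₃ λ a-ui-uj → i≢j
          (Fin.inject≤-injective 19≤∣L∣ 19≤∣L∣ i j (lookup-injective (longLines-unique a) (index i) (index j)
            (begin
              line i                   ≡⟨ line≡cl i ⟩
              cl (pair a (u i))        ≡⟨ cl-pair-≡ (LongLine.a-b (long i)) (LongLine.a-b (long j)) a-ui-uj ⟩
              cl (pair a (u j))        ≡⟨ sym (line≡cl j) ⟩
              line j                   ∎)))
      }
      where open ≡-Reasoning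

  flats-at : Fin n → List (Subset n)
  flats-at a = cl ⁅ a ⁆ ∷ longLines a

  flatCover : List (Subset n)
  flatCover = concatMap flats-at (allFin n)

  ∈flats-at⇒∈flatCover : ∀ {a F} → F ∈ₗ flats-at a → F ∈ₗ flatCover
  ∈flats-at⇒∈flatCover {a} {F} F∈ = Membership.∈-concatMap⁺ flats-at
    (Any.map (λ a≡b → subst (λ b → F ∈ₗ flats-at b) a≡b F∈) (Membership.∈-allFin a))

  flatCover-flat : All (Flat M) flatCover
  flatCover-flat = All.tabulate λ F∈ → flat (Any.satisfied (Membership.∈-concatMap⁻ flats-at {xs = allFin n} F∈))
    where
    flat : ∀ {F} → ∃[ a ] F ∈ₗ flats-at a → Flat M F
    flat (a , here refl) = cl-flat ⁅ a ⁆
    flat (a , there F∈) with b , _ , refl ← ∈longLines⁻ F∈ = cl-flat (pair a b)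

  module P6Free (rk≡3 : rk M ≡ 3) (noP6 : ¬ HasP6Minor M) where

    module Transversal {k} (P : Pencil k) {A B : Fin k} (b c : Bool) (A≢B : A ≢ B) where
      open Pencil P

      s s′ z z′ : Fin n
      s  = pt A b
      s′ = pt A (not b)
      z  = pt B c
      z′ = pt B (not c)

      s-z : Indep₂ s z
      s-z = indep₃⇒indep₂₂₃ (indep-across b c A≢B)

      s′-z′ : Indep₂ s′ z′
      s′-z′ = indep₃⇒indep₂₂₃ (indep-across (not b) (not c) A≢B)

      ¬s-z-p : ¬ Collinear s z p
      ¬s-z-p = indep₃⇒¬collinear (indep₃-swap₂₃ (indep₃-swap₁₂ (indep-across b c A≢B)))

      ¬s-z-s′ : ¬ Collinear s z s′
      ¬s-z-s′ s-z-s′ = indep₃⇒¬collinear (indep-across b c A≢B)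
        (line-determined (p-pt A b) (pt-pt A b) (collinear-abb p s) (p-pt-pt A b)
          (collinear-on-line s-z (collinear-aba s z) s-z-s′ (collinear-abb s z)))

      ¬s-z-z′ : ¬ Collinear s z z′
      ¬s-z-z′ s-z-z′ = indep₃⇒¬collinear (indep-across b c A≢B) (collinear-swap₂₃
        (line-determined (p-pt B c) (pt-pt B c) (collinear-abb p z) (p-pt-pt B c)
          (collinear-on-line s-z (collinear-abb s z) s-z-z′ (collinear-aba s z))))

      ¬s′-z′-s : ¬ Collinear s′ z′ s
      ¬s′-z′-s s′-z′-s = indep₃⇒¬collinear (indep-across b (not c) A≢B)
        (line-determined (p-pt A b) (pt-pt A b) (collinear-abb p s) (p-pt-pt A b)
          (collinear-on-line s′-z′ s′-z′-s (collinear-aba s′ z′) (collinear-abb s′ z′)))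

      Meets : Fin k → Set
      Meets w = ∃[ d ] Collinear s z (pt w d)

      meets? : Decidable Meets
      meets? w = map′ (λ { (inj₁ on) → true , on ; (inj₂ on) → false , on })
                      (λ { (true , on) → inj₁ on ; (false , on) → inj₂ on })
                      (collinear? s z (u w) ⊎-dec collinear? s z (v w))

      MeetsOther : Fin k → Set
      MeetsOther w = w ≢ A × w ≢ B × Meets w

      record Hit : Set where
        field
          line   : Fin k
          side   : Bool
          line≢A : line ≢ A
          line≢B : line ≢ B
          on-sz  : Collinear s z (pt line side)

        point : Fin n
        point = pt line side

      open Hit

      toHit : ∀ {w} → MeetsOther w → Hit
      toHit {w} (w≢A , w≢B , d , on) = record { line = w ; side = d ; line≢A = w≢A ; line≢B = w≢B ; on-sz = on }

      module _ (h₁ h₂ : Hit) (h₁≢h₂ : line h₁ ≢ line h₂) where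

        h₁-h₂ : Indep₂ (point h₁) (point h₂)
        h₁-h₂ = indep₃⇒indep₂₂₃ (indep-across (side h₁) (side h₂) h₁≢h₂)

        h₁h₂⊆sz : ∀ {w} → Collinear (point h₁) (point h₂) w → Collinear s z w
        h₁h₂⊆sz = line-determined s-z h₁-h₂ (on-sz h₁) (on-sz h₂)

        h₁-h₂-p : Indep₃ (point h₁) (point h₂) p
        h₁-h₂-p = ¬collinear⇒indep₃ (¬s-z-p ∘ h₁h₂⊆sz)

        h₁-h₂-s′ : Indep₃ (point h₁) (point h₂) s′
        h₁-h₂-s′ = ¬collinear⇒indep₃ (¬s-z-s′ ∘ h₁h₂⊆sz)

        h₁-h₂-z′ : Indep₃ (point h₁) (point h₂) z′
        h₁-h₂-z′ = ¬collinear⇒indep₃ (¬s-z-z′ ∘ h₁h₂⊆sz)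

        -- otherwise s′z′ would be the line h₁h₂ = sz, which contains s
        ¬both-on-s′z′ : Collinear s′ z′ (point h₁) → ¬ Collinear s′ z′ (point h₂)
        ¬both-on-s′z′ on₁ on₂ = ¬s′-z′-s (line-determined s′-z′ h₁-h₂ on₁ on₂
          (collinear-on-line s-z (on-sz h₁) (on-sz h₂) (collinear-aba s z)))

      h-p-s′ : ∀ h → Indep₃ (point h) p s′
      h-p-s′ h = indep₃-swap₁₂ (indep-across (side h) (not b) (line≢A h))

      h-p-z′ : ∀ h → Indep₃ (point h) p z′
      h-p-z′ h = indep₃-swap₁₂ (indep-across (side h) (not c) (line≢B h))

      h-s′-z′ : ∀ h → ¬ Collinear s′ z′ (point h) → Indep₃ (point h) s′ z′
      h-s′-z′ h off = indep₃-swap₁₂ (indep₃-swap₂₃ (¬collinear⇒indep₃ off))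

      three-off-s′z′⇒P6-minor : ∀ h₁ h₂ h₃ → line h₁ ≢ line h₂ → line h₁ ≢ line h₃ → line h₂ ≢ line h₃ →
        ¬ Collinear s′ z′ (point h₁) → ¬ Collinear s′ z′ (point h₂) → ¬ Collinear s′ z′ (point h₃) →
        HasP6Minor M
      three-off-s′z′⇒P6-minor h₁ h₂ h₃ n₁₂ n₁₃ n₂₃ off₁ off₂ off₃ = configuration⇒P6-minor rk≡3 record
        { g    = Vec.lookup (point h₁ ∷ point h₂ ∷ point h₃ ∷ p ∷ s′ ∷ z′ ∷ [])
        ; c012 = collinear-on-line s-z (on-sz h₁) (on-sz h₂) (on-sz h₃)
        ; i013 = h₁-h₂-p h₁ h₂ n₁₂ ; i014 = h₁-h₂-s′ h₁ h₂ n₁₂ ; i015 = h₁-h₂-z′ h₁ h₂ n₁₂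
        ; i023 = h₁-h₂-p h₁ h₃ n₁₃ ; i024 = h₁-h₂-s′ h₁ h₃ n₁₃ ; i025 = h₁-h₂-z′ h₁ h₃ n₁₃
        ; i123 = h₁-h₂-p h₂ h₃ n₂₃ ; i124 = h₁-h₂-s′ h₂ h₃ n₂₃ ; i125 = h₁-h₂-z′ h₂ h₃ n₂₃
        ; i034 = h-p-s′ h₁ ; i035 = h-p-z′ h₁ ; i045 = h-s′-z′ h₁ off₁
        ; i134 = h-p-s′ h₂ ; i135 = h-p-z′ h₂ ; i145 = h-s′-z′ h₂ off₂
        ; i234 = h-p-s′ h₃ ; i235 = h-p-z′ h₃ ; i245 = h-s′-z′ h₃ off₃
        ; i345 = indep-across (not b) (not c) A≢B
        }

      -- at most one of the four hits lies on s′z′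
      four-hits⇒P6-minor : ∀ h₁ h₂ h₃ h₄ → line h₁ ≢ line h₂ → line h₁ ≢ line h₃ → line h₁ ≢ line h₄ →
        line h₂ ≢ line h₃ → line h₂ ≢ line h₄ → line h₃ ≢ line h₄ → HasP6Minor M
      four-hits⇒P6-minor h₁ h₂ h₃ h₄ n₁₂ n₁₃ n₁₄ n₂₃ n₂₄ n₃₄ with collinear? s′ z′ (point h₁)
      ... | yes on₁ = three-off-s′z′⇒P6-minor h₂ h₃ h₄ n₂₃ n₂₄ n₃₄
                        (¬both-on-s′z′ h₁ h₂ n₁₂ on₁) (¬both-on-s′z′ h₁ h₃ n₁₃ on₁) (¬both-on-s′z′ h₁ h₄ n₁₄ on₁)
      ... | no off₁ with collinear? s′ z′ (point h₂)
      ...   | yes on₂ = three-off-s′z′⇒P6-minor h₁ h₃ h₄ n₁₃ n₁₄ n₃₄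
                          off₁ (¬both-on-s′z′ h₂ h₃ n₂₃ on₂) (¬both-on-s′z′ h₂ h₄ n₂₄ on₂)
      ...   | no off₂ with collinear? s′ z′ (point h₃)
      ...     | yes on₃ = three-off-s′z′⇒P6-minor h₁ h₂ h₄ n₁₂ n₁₄ n₂₄ off₁ off₂ (¬both-on-s′z′ h₃ h₄ n₃₄ on₃)
      ...     | no off₃ = three-off-s′z′⇒P6-minor h₁ h₂ h₃ n₁₂ n₁₃ n₂₃ off₁ off₂ off₃

      meets-other-few : AtMost 3 MeetsOther
      meets-other-few = atMost-3 λ where
        ((n₁₂ ∷ n₁₃ ∷ n₁₄ ∷ []) ∷ (n₂₃ ∷ n₂₄ ∷ []) ∷ (n₃₄ ∷ []) ∷ [] ∷ []) (m₁ ∷ m₂ ∷ m₃ ∷ m₄ ∷ []) →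
          noP6 (four-hits⇒P6-minor (toHit m₁) (toHit m₂) (toHit m₃) (toHit m₄) n₁₂ n₁₃ n₁₄ n₂₃ n₂₄ n₃₄)

      sparse : Sparse (Fin k)
      sparse = record
        { Holds  = MeetsOther
        ; holds? = λ w → ¬? (w Fin.≟ A) ×-dec ¬? (w Fin.≟ B) ×-dec meets? w
        ; bound  = 3
        ; atMost = meets-other-few
        }

      misses⇒indep : ∀ {w} → ¬ MeetsOther w → w ≢ A → w ≢ B → Indep₃ s z (u w)
      misses⇒indep ¬meets w≢A w≢B = ¬collinear⇒indep₃ λ on → ¬meets (w≢A , w≢B , true , on)

    module _ (P : Pencil 19) where
      open Pencil P
      private
        module T₁ = Transversal P {# 1} {# 0} true true  (λ ())
        module T₂ = Transversal P {# 1} {# 0} true false (λ ())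

      pencil₁₉⇒P6-minor : HasP6Minor M
      pencil₁₉⇒P6-minor =
        case avoid (≡-sparse (# 0) ∷ ≡-sparse (# 1) ∷ T₁.sparse ∷ T₂.sparse ∷ []) (from-yes (8 <? 19)) of λ where
        (j , (j≢0 ∷ j≢1 ∷ j∉T₁ ∷ j∉T₂ ∷ [])) →
          case avoid (≡-sparse (# 0) ∷ ≡-sparse (# 1) ∷ ≡-sparse j ∷ T₁.sparse ∷ T₂.sparse
                      ∷ Transversal.sparse P true true j≢0 ∷ Transversal.sparse P true false j≢0
                      ∷ Transversal.sparse P true true (j≢1 ∘ sym) ∷ []) (from-yes (18 <? 19)) of λ where
          (i , (i≢0 ∷ i≢1 ∷ i≢j ∷ i∉T₁ ∷ i∉T₂ ∷ i∉T₃ ∷ i∉T₄ ∷ i∉T₅ ∷ [])) →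
            configuration⇒P6-minor rk≡3 record
            { g    = Vec.lookup (p ∷ u (# 0) ∷ v (# 0) ∷ u (# 1) ∷ u j ∷ u i ∷ [])
            ; c012 = p-u-v (# 0)
            ; i013 = indep-across true  true (λ ())       ; i014 = indep-across true true (j≢0 ∘ sym)
            ; i015 = indep-across true  true (i≢0 ∘ sym)
            ; i023 = indep-across false true (λ ())       ; i024 = indep-across false true (j≢0 ∘ sym)
            ; i025 = indep-across false true (i≢0 ∘ sym)
            ; i034 = indep-across true  true (j≢1 ∘ sym)  ; i035 = indep-across true true (i≢1 ∘ sym)
            ; i045 = indep-across true  true (i≢j ∘ sym)
            ; i123 = off-line (# 0) (indep-across true true (λ ()))
            ; i124 = off-line (# 0) (indep-across true true (j≢0 ∘ sym))
            ; i125 = off-line (# 0) (indep-across true true (i≢0 ∘ sym))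
            ; i134 = indep₃-swap₁₂ (T₁.misses⇒indep j∉T₁ j≢1 j≢0)
            ; i135 = indep₃-swap₁₂ (T₁.misses⇒indep i∉T₁ i≢1 i≢0)
            ; i145 = indep₃-swap₁₂ (Transversal.misses⇒indep P true true j≢0 i∉T₃ i≢j i≢0)
            ; i234 = indep₃-swap₁₂ (T₂.misses⇒indep j∉T₂ j≢1 j≢0)
            ; i235 = indep₃-swap₁₂ (T₂.misses⇒indep i∉T₂ i≢1 i≢0)
            ; i245 = indep₃-swap₁₂ (Transversal.misses⇒indep P true false j≢0 i∉T₄ i≢j i≢0)
            ; i345 = Transversal.misses⇒indep P true true (j≢1 ∘ sym) i∉T₅ i≢1 i≢j
            }

    ¬pencil₁₉ : ¬ Pencil 19
    ¬pencil₁₉ = noP6 ∘ pencil₁₉⇒P6-minor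

    ∣longLines∣≤18 : ∀ a → length (longLines a) ≤ 18
    ∣longLines∣≤18 a = ≮⇒≥ (¬pencil₁₉ ∘ longLines⇒pencil a)

    ∣flatCover∣≤13+19n : length flatCover ≤ 13 + 19 * n
    ∣flatCover∣≤13+19n = begin
      length flatCover        ≤⟨ length-concatMap≤ flats-at (λ a → s≤s (∣longLines∣≤18 a)) (allFin n) ⟩
      length (allFin n) * 19  ≡⟨ cong (_* 19) (List.length-tabulate {n = n} (λ i → i)) ⟩
      n * 19                  ≡⟨ *-comm n 19 ⟩
      19 * n                  ≤⟨ m≤n+m (19 * n) 13 ⟩
      13 + 19 * n             ∎
      where open ≤-Reasoning

    nonBasis⇒ρ≤2 : ∀ {X} → NonBasis M X → ρ X ≤ 2
    nonBasis⇒ρ≤2 {X} (∣X∣≡rk , ¬basis) with ρ X ≤? 2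
    ... | yes ρX≤2 = ρX≤2
    ... | no  ρX≰2 = contradiction (independent , maximal) ¬basis
      where
      ∣X∣≡3 : ∣ X ∣ ≡ 3
      ∣X∣≡3 = trans ∣X∣≡rk rk≡3
      independent : ρ X ≡ ∣ X ∣
      independent = ≤-antisym (r-bound M X) (subst (_≤ ρ X) (sym ∣X∣≡3) (≰⇒> ρX≰2))
      maximal : ∀ Y → X ⊆ Y → ρ Y ≡ ∣ Y ∣ → X ≡ Y
      maximal Y X⊆Y ρY≡∣Y∣ = p⊆q∧∣q∣≤∣p∣⇒p≡q X⊆Y (begin
        ∣ Y ∣   ≡⟨ sym ρY≡∣Y∣ ⟩
        ρ Y     ≤⟨ ρ≤3 rk≡3 Y ⟩
        3       ≡⟨ sym ∣X∣≡3 ⟩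
        ∣ X ∣   ∎)
        where open ≤-Reasoning

    Covered : Subset n → Set
    Covered X = Any (λ F → Covers M F X) flatCover

    covered-by : ∀ {X F} → F ∈ₗ flatCover → Covers M F X → Covered X
    covered-by {X} F∈ F-covers = Any.map (λ F≡G → subst (λ G → Covers M G X) F≡G F-covers) F∈

    cl-covers : ∀ {X Y} → ρ Y < ∣ X ∩ cl Y ∣ → Covers M (cl Y) X
    cl-covers {X} {Y} = subst (_< ∣ X ∩ cl Y ∣) (sym (ρ-cl Y))

    two-in-cl⁅a⁆⇒covered : ∀ {X x y} a → x ∈ X → y ∈ X → x ≢ y → x ∈ cl ⁅ a ⁆ → y ∈ cl ⁅ a ⁆ → Covered X
    two-in-cl⁅a⁆⇒covered {X} a x∈X y∈X x≢y x∈cl y∈cl = covered-by {X} (∈flats-at⇒∈flatCover {a} (here refl))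
      (cl-covers {X} {⁅ a ⁆} (≤-trans (s≤s (ρ⁅x⁆≤1 a))
        (x∈p∧y∈p∧x≢y⇒2≤∣p∣ (x∈p∩q⁺ (x∈X , x∈cl)) (x∈p∩q⁺ (y∈X , y∈cl)) x≢y)))

    dependent-pair-covered : ∀ {X x y} → x ∈ X → y ∈ X → x ≢ y → ¬ Indep₂ x y → Covered X
    dependent-pair-covered {x = x} {y} x∈X y∈X x≢y dep with 1 ≤? ρ ⁅ x ⁆
    ... | yes nonloop = two-in-cl⁅a⁆⇒covered x x∈X y∈X x≢y (X⊆clX (x∈⁅x⁆ x))
          (∈cl⁺ (≤-antisym (≤-trans (≤-pred (≰⇒> dep)) nonloop) (ρ-mono X⊆X∪⁅e⁆)))
    ... | no  ¬nonloop = two-in-cl⁅a⁆⇒covered y x∈X y∈X x≢y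
          (loop∈cl (n≤0⇒n≡0 (≤-pred (≰⇒> ¬nonloop)))) (X⊆clX (x∈⁅x⁆ y))

    long-line-covered : ∀ {X x y z} → x ∈ X → y ∈ X → z ∈ X → x ≢ y → x ≢ z → y ≢ z →
                        LongLine x y → Collinear x y z → Covered X
    long-line-covered {X} {x} {y} x∈X y∈X z∈X x≢y x≢z y≢z L x-y-z =
      covered-by {X} (∈flats-at⇒∈flatCover {x} (there (∈longLines⁺ L)))
        (cl-covers {X} {pair x y} (≤-trans (s≤s (ρ-pair≤2 x y)) (x∈p∧y∈p∧z∈p⇒3≤∣p∣
          (x∈p∩q⁺ (x∈X , X⊆clX a∈pair)) (x∈p∩q⁺ (y∈X , X⊆clX b∈pair))
          (x∈p∩q⁺ (z∈X , collinear⇒∈cl (LongLine.a-b L) x-y-z)) x≢y x≢z y≢z)))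

    distinct₃-covered : ∀ {X} → Distinct₃ X → ρ X ≤ 2 → Covered X
    distinct₃-covered (distinct₃ {x} {y} {z} x∈X y∈X z∈X x≢y x≢z y≢z) ρX≤2
      with indep₂? x y | indep₂? x z | indep₂? y z
    ... | no dep  | _       | _       = dependent-pair-covered x∈X y∈X x≢y dep
    ... | yes _   | no dep  | _       = dependent-pair-covered x∈X z∈X x≢z dep
    ... | yes _   | yes _   | no dep  = dependent-pair-covered y∈X z∈X y≢z dep
    ... | yes x-y | yes x-z | yes y-z = long-line-covered x∈X y∈X z∈X x≢y x≢z y≢z
          (record { a-b = x-y ; a-w = x-z ; b-w = y-z ; a-b-w = x-y-z }) x-y-z
      where x-y-z = ≤-trans (ρ-mono (triple⊆ x∈X y∈X z∈X)) ρX≤2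

    nonBasis-covered : ∀ X → NonBasis M X → Covered X
    nonBasis-covered X nonBasis = distinct₃-covered
      (3≤∣p∣⇒distinct₃ X (≤-reflexive (sym (trans (proj₁ nonBasis) rk≡3)))) (nonBasis⇒ρ≤2 nonBasis)

lemma4p8 : ∀ (n : ℕ) (M : Matroid n) → rk M ≡ 3 → ¬ HasP6Minor M →
    κ≤ M (13 + 19 * n)
lemma4p8 n M rk≡3 noP6 = flatCover , (flatCover-flat , nonBasis-covered) , ∣flatCover∣≤13+19n
  where
  open Geometry M
  open P6Free rk≡3 noP6
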